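{- $\bigcup_{n=0}^{\infty}\Psi^n[\mathbf{SFQ}_{\mathrm P}^{ -\neg}]\subsetneq\mathbf{SFQ}_{\mathrm P}$.
   Context: Language: $\mathcal{L}$ is a first-order language with $\top,\bot$, connectives $\land,\lor,\to,\neg$ ($\neg$ primitive, distinct from $A\to\bot$), $\forall,\exists$, countably many variables, constants, function and predicate symbols, including a distinguished unary predicate $E$. $\sim A$ abbreviates $A\to\bot$. $\mathcal{L}(D)$ adds constants $\overline d$ for $d\in D$. GN formulas: $N::=\bot\mid\neg A\mid N\land N\mid N\lor N\mid N\to N\mid\forall xN\mid\exists xN$; $\forall xA$/$\exists xA$ is global if $x$ occurs free in $A$ and all its free occurrences lie inside GN subformulas, local otherwise. Strict finitistic model $W=\langle K,\le,D,J,v\rangle$: rooted tree (countable branching, height $\le\omega$), nonempty constant domain $D$, compositional interpretation $J$ of closed $\mathcal{L}(D)$-terms with $J(\overline d)=d$, monotone extensions $P^{v(k)}\subseteq D^n$, strictness (values of all subterms of arguments of an atom true at a node lie in $E$'s extension there), finite verification (finitely many predicates with nonempty extension per node). Forcing: atoms via $v(k)$; $\top$ forced, $\bot$ not; $\land,\lor$ componentwise; $k\models A\to B$ iff every $k'\ge k$ forcing $A$ has some $k''\ge k'$ forcing $B$; $k\models\neg A$ iff no node forces $A$; $k\models\forall xA$ iff for all $d$, $k\models\top\to A[\overline d/x]$ (global) or $k\models E(\overline d)\to A[\overline d/x]$ (local); $k\models\exists xA$ iff for some $d$, $k\models A[\overline d/x]$ (global) or $k\models E(\overline d)\land A[\overline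 d/x]$ (local). $W$ is prevalent if every closed $\mathcal{L}(D)$-formula forced at some node is prevalent (each node has some node above-or-equal forcing it) and $E(\overline d)$ is prevalent for all $d\in D$. $\mathbf{SFQ}_{\mathrm P}$ is the set of closed $\mathcal{L}$-formulas forced at every node of every prevalent model (the paper defines it as the set of theorems of its natural deduction system $\mathbf{NSF}_{\mathrm P}$, which it proves sound and complete for prevalent models); $\mathbf{SFQ}_{\mathrm P}^{ -\neg}$ is the set of its members not containing $\neg$. For a formula $A$, $\Psi(A)$ is the set of formulas obtained from $A$ by replacing one occurrence of a subformula of the form $B\to\bot$ by $\neg B$; for a set $X$, $\Psi[X]=\bigcup_{A\in X}\Psi(A)$, $\Psi^0[X]=X$, $\Psi^{n+1}[X]=\Psi[\Psi^n[X]]$. -}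

module Defs where

open import Data.Nat using (ℕ; zero; suc; _⊔_; _≡ᵇ_)
open import Data.Bool using (Bool; true; false; _∧_; _∨_; not; if_then_else_; T)
open import Data.List using (List; []; _++_)
open import Data.List.Membership.Propositional using (_∈_)
open import Data.Vec using (Vec; []; _∷_)
open import Data.Vec.Relation.Unary.Any using (Any)
open import Data.Empty renaming (⊥ to Empty; ⊥-elim to Empty-elim)
open import Data.Unit using () renaming (⊤ to Unit)
open import Data.Product using (Σ; _×_; _,_; proj₁)
open import Data.Sum using (_⊎_)
open import Relation.Nullary using (¬_)
open import Relation.Binary.PropositionalEquality using (_≡_)

-- Terms/formulas are
-- parameterised by a set P of extra constants: P = Empty gives the
-- language L, P = D gives L(D) (constant  par d  is  \overline d).

data PSym : Set where
  E   : PSym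
  Pr  : (i n : ℕ) → PSym

arity : PSym → ℕ
arity E        = 1
arity (Pr i n) = n

data Term (P : Set) : Set where
  var : ℕ → Term P
  con : ℕ → Term P
  fun : (i n : ℕ) → Vec (Term P) n → Term P
  par : P → Term P

infixr 6 _∧'_
infixr 5 _∨'_
infixr 4 _⇒_

data Formula (P : Set) : Set where
  atom : (p : PSym) → Vec (Term P) (arity p) → Formula P
  ⊤' ⊥' : Formula P
  _∧'_ _∨'_ _⇒_ : Formula P → Formula P → Formula P
  ¬'_ : Formula P → Formula P
  ∀' ∃' : ℕ → Formula P → Formula P

∼_ : ∀ {P} → Formula P → Formula P
∼ A = A ⇒ ⊥'

mutual
  occT : ∀ {P} → ℕ → Term P → Bool
  occT x (var y)     = x ≡ᵇ y
  occT x (con c)     = false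
  occT x (fun i n ts) = occV x ts
  occT x (par d)     = false

  occV : ∀ {P n} → ℕ → Vec (Term P) n → Bool
  occV x []       = false
  occV x (t ∷ ts) = occT x t ∨ occV x ts

freeIn : ∀ {P} → ℕ → Formula P → Bool
freeIn x (atom p ts) = occV x ts
freeIn x ⊤'          = false
freeIn x ⊥'          = false
freeIn x (A ∧' B)    = freeIn x A ∨ freeIn x B
freeIn x (A ∨' B)    = freeIn x A ∨ freeIn x B
freeIn x (A ⇒ B)     = freeIn x A ∨ freeIn x B
freeIn x (¬' A)      = freeIn x A
freeIn x (∀' y A)    = if x ≡ᵇ y then false else freeIn x A
freeIn x (∃' y A)    = if x ≡ᵇ y then false else freeIn x A

Closed : ∀ {P} → Formula P → Set
Closed A = ∀ x → freeIn x A ≡ false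


isGN : ∀ {P} → Formula P → Bool
isGN (atom p ts) = false
isGN ⊤'          = false
isGN ⊥'          = true
isGN (A ∧' B)    = isGN A ∧ isGN B
isGN (A ∨' B)    = isGN A ∧ isGN B
isGN (A ⇒ B)     = isGN A ∧ isGN B
isGN (¬' A)      = true
isGN (∀' y A)    = isGN A
isGN (∃' y A)    = isGN A

freeOutsideGN : ∀ {P} → ℕ → Formula P → Bool
freeOutsideGN x A with isGN A
... | true  = false
freeOutsideGN x (atom p ts) | false = occV x ts
freeOutsideGN x ⊤'          | false = false
freeOutsideGN x ⊥'          | false = false
freeOutsideGN x (A ∧' B)    | false = freeOutsideGN x A ∨ freeOutsideGN x B
freeOutsideGN x (A ∨' B)    | false = freeOutsideGN x A ∨ freeOutsideGN x B
freeOutsideGN x (A ⇒ B)     | false = freeOutsideGN x A ∨ freeOutsideGN x B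
freeOutsideGN x (¬' A)      | false = false
freeOutsideGN x (∀' y A)    | false = if x ≡ᵇ y then false else freeOutsideGN x A
freeOutsideGN x (∃' y A)    | false = if x ≡ᵇ y then false else freeOutsideGN x A

global : ∀ {P} → ℕ → Formula P → Bool
global x A = freeIn x A ∧ not (freeOutsideGN x A)

-- substitution of a closed term (a parameter) for a variable

mutual
  substT : ∀ {P} → ℕ → Term P → Term P → Term P
  substT x s (var y)      = if x ≡ᵇ y then s else var y
  substT x s (con c)      = con c
  substT x s (fun i n ts) = fun i n (substV x s ts)
  substT x s (par d)      = par d

  substV : ∀ {P n} → ℕ → Term P → Vec (Term P) n → Vec (Term P) n
  substV x s []       = []
  substV x s (t ∷ ts) = substT x s t ∷ substV x s ts

subst : ∀ {P} → ℕ → Term P → Formula P → Formula P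
subst x s (atom p ts) = atom p (substV x s ts)
subst x s ⊤'          = ⊤'
subst x s ⊥'          = ⊥'
subst x s (A ∧' B)    = subst x s A ∧' subst x s B
subst x s (A ∨' B)    = subst x s A ∨' subst x s B
subst x s (A ⇒ B)     = subst x s A ⇒ subst x s B
subst x s (¬' A)      = ¬' subst x s A
subst x s (∀' y A)    = if x ≡ᵇ y then ∀' y A else ∀' y (subst x s A)
subst x s (∃' y A)    = if x ≡ᵇ y then ∃' y A else ∃' y (subst x s A)

rank : ∀ {P} → Formula P → ℕ
rank (atom p ts) = 0
rank ⊤'          = 0
rank ⊥'          = 0
rank (A ∧' B)    = suc (rank A ⊔ rank B)
rank (A ∨' B)    = suc (rank A ⊔ rank B)
rank (A ⇒ B)     = suc (rank A ⊔ rank B)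
rank (¬' A)      = suc (rank A)
rank (∀' y A)    = suc (rank A)
rank (∃' y A)    = suc (rank A)

mutual
  embT : ∀ {D} → Term Empty → Term D
  embT (var x)      = var x
  embT (con c)      = con c
  embT (fun i n ts) = fun i n (embV ts)
  embT (par ())

  embV : ∀ {D n} → Vec (Term Empty) n → Vec (Term D) n
  embV []       = []
  embV (t ∷ ts) = embT t ∷ embV ts

emb : ∀ {D} → Formula Empty → Formula D
emb (atom p ts) = atom p (embV ts)
emb ⊤'          = ⊤'
emb ⊥'          = ⊥'
emb (A ∧' B)    = emb A ∧' emb B
emb (A ∨' B)    = emb A ∨' emb B
emb (A ⇒ B)     = emb A ⇒ emb B
emb (¬' A)      = ¬' emb A
emb (∀' y A)    = ∀' y (emb A)
emb (∃' y A)    = ∃' y (emb A)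

mutual
  data SubtermOf {P : Set} (s : Term P) : Term P → Set where
    here  : SubtermOf s s
    there : ∀ {i n} {ts : Vec (Term P) n} → SubtermOfArgs s ts → SubtermOf s (fun i n ts)

  SubtermOfArgs : {P : Set} → Term P → ∀ {n} → Vec (Term P) n → Set
  SubtermOfArgs s ts = Any (SubtermOf s) ts

-- Trees: a rooted tree with countable branching and height ≤ ω is
-- presented as a prefix-closed set of finite sequences of naturals
-- containing the empty sequence (the root), ordered by prefix.

_≼_ : List ℕ → List ℕ → Set
l ≼ l' = Σ (List ℕ) λ m → l ++ m ≡ l'

-- the compositional interpretation of closed L(D)-terms determined by
-- interpretations of the constant and function symbols, with J(d̄) = d
-- (variables, which never occur in closed terms, are sent to d₀)
module _ {D : Set} (d₀ : D) (conI : ℕ → D) (funI : (i n : ℕ) → Vec D n → D) where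
  mutual
    Jof : Term D → D
    Jof (var x)      = d₀
    Jof (con c)      = conI c
    Jof (fun i n ts) = funI i n (JVof ts)
    Jof (par d)      = d

    JVof : ∀ {n} → Vec (Term D) n → Vec D n
    JVof []       = []
    JVof (t ∷ ts) = Jof t ∷ JVof ts

record Model : Set₁ where
  field
    InK        : List ℕ → Set
    root       : InK []
    prefClosed : ∀ l m → InK (l ++ m) → InK l
    D          : Set
    d₀         : D
    conI       : ℕ → D
    funI       : (i n : ℕ) → Vec D n → D
    ext        : Σ (List ℕ) InK → (p : PSym) → Vec D (arity p) → Set
    monotone   : ∀ {k k'} → proj₁ k ≼ proj₁ k' → ∀ p ds → ext k p ds → ext k' p ds
    strict     : ∀ k p (ts : Vec (Term D) (arity p)) →
                 (∀ x → occV x ts ≡ false) →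
                 ext k p (JVof d₀ conI funI ts) →
                 ∀ s → SubtermOfArgs s ts → ext k E (Jof d₀ conI funI s ∷ [])
    finVerif   : ∀ k → Σ (List PSym) λ L → ∀ p ds → ext k p ds → p ∈ L

module _ (W : Model) where
  open Model W

  Node : Set
  Node = Σ (List ℕ) InK

  _≤_ : Node → Node → Set
  k ≤ k' = proj₁ k ≼ proj₁ k'

  J : Term D → D
  J = Jof d₀ conI funI

  JV : ∀ {n} → Vec (Term D) n → Vec D n
  JV = JVof d₀ conI funI

  Imp : Node → (Node → Set) → (Node → Set) → Set
  Imp k φ ψ = ∀ k' → k ≤ k' → φ k' → Σ Node λ k'' → k' ≤ k'' × ψ k''

  -- forcing with fuel n (for n ≥ rank A the fuel is irrelevant)
  forceF : ℕ → Node → Formula D → Set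
  forceF n k (atom p ts) = ext k p (JV ts)
  forceF n k ⊤' = Unit
  forceF n k ⊥' = Empty
  forceF zero k _ = Empty
  forceF (suc n) k (A ∧' B) = forceF n k A × forceF n k B
  forceF (suc n) k (A ∨' B) = forceF n k A ⊎ forceF n k B
  forceF (suc n) k (A ⇒ B) = Imp k (λ k' → forceF n k' A) (λ k'' → forceF n k'' B)
  forceF (suc n) k (¬' A) = ¬ (Σ Node λ k' → forceF n k' A)
  forceF (suc n) k (∀' x A) with global x A
  ... | true  = ∀ d → Imp k (λ _ → Unit) (λ k'' → forceF n k'' (subst x (par d) A))
  ... | false = ∀ d → Imp k (λ k' → forceF 0 k' (atom E (par d ∷ [])))
                             (λ k'' → forceF n k'' (subst x (par d) A))
  forceF (suc n) k (∃' x A) with global x A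
  ... | true  = Σ D λ d → forceF n k (subst x (par d) A)
  ... | false = Σ D λ d → forceF 0 k (atom E (par d ∷ [])) × forceF n k (subst x (par d) A)

  _⊩_ : Node → Formula D → Set
  k ⊩ A = forceF (rank A) k A

  Prevalent : Set
  Prevalent =
    (∀ (A : Formula D) → Closed A → (Σ Node λ k → k ⊩ A) →
       ∀ k → Σ Node λ k' → k ≤ k' × k' ⊩ A)
    × (∀ (d : D) k → Σ Node λ k' → k ≤ k' × k' ⊩ atom E (par d ∷ []))

Fml : Set
Fml = Formula Empty

SFQP : Fml → Set₁
SFQP A = Closed A × ((W : Model) → Prevalent W →
                       ∀ (k : Node W) → _⊩_ W k (emb A))

noNeg : ∀ {P} → Formula P → Bool
noNeg (atom p ts) = true
noNeg ⊤'          = true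
noNeg ⊥'          = true
noNeg (A ∧' B)    = noNeg A ∧ noNeg B
noNeg (A ∨' B)    = noNeg A ∧ noNeg B
noNeg (A ⇒ B)     = noNeg A ∧ noNeg B
noNeg (¬' A)      = false
noNeg (∀' y A)    = noNeg A
noNeg (∃' y A)    = noNeg A

SFQP⁻ : Fml → Set₁
SFQP⁻ A = SFQP A × T (noNeg A)

data Ψ {P : Set} : Formula P → Formula P → Set where
  step : ∀ {B} → Ψ (B ⇒ ⊥') (¬' B)
  ∧ˡ : ∀ {A A' B} → Ψ A A' → Ψ (A ∧' B) (A' ∧' B)
  ∧ʳ : ∀ {A B B'} → Ψ B B' → Ψ (A ∧' B) (A ∧' B')
  ∨ˡ : ∀ {A A' B} → Ψ A A' → Ψ (A ∨' B) (A' ∨' B)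
  ∨ʳ : ∀ {A B B'} → Ψ B B' → Ψ (A ∨' B) (A ∨' B')
  ⇒ˡ : ∀ {A A' B} → Ψ A A' → Ψ (A ⇒ B) (A' ⇒ B)
  ⇒ʳ : ∀ {A B B'} → Ψ B B' → Ψ (A ⇒ B) (A ⇒ B')
  ¬c : ∀ {A A'} → Ψ A A' → Ψ (¬' A) (¬' A')
  ∀c : ∀ {x A A'} → Ψ A A' → Ψ (∀' x A) (∀' x A')
  ∃c : ∀ {x A A'} → Ψ A A' → Ψ (∃' x A) (∃' x A')

Ψ^ : ℕ → (Fml → Set₁) → Fml → Set₁
Ψ^ zero    X A = X A
Ψ^ (suc n) X A = Σ Fml λ A' → Ψ^ n X A' × Ψ A' A

⋃Ψ : Fml → Set₁
⋃Ψ A = Σ ℕ λ n → Ψ^ n SFQP⁻ A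

{-# OPTIONS --safe #-}
-- In a prevalent model a closed formula forced at some node is forced above every node, so for
-- closed B the formulas ¬B and B → ⊥ hold at the same nodes. By induction on the rank, replacing
-- B → ⊥ by ¬B inside a closed formula therefore preserves forcing; at contravariant positions this
-- needs the converse replacement, which preserves forcing only up to an extension of the node.
-- For strictness, rewriting every ¬B as B → ⊥ undoes each Ψ-step and fixes ¬-free formulas, so it
-- maps ⋃ₙ Ψⁿ[SFQ⁻] into SFQ. But ∃x ¬¬E(x) is valid, as E(d̄) is prevalent, while its rewrite
-- ∃x ((E(x) → ⊥) → ⊥) is a local existential, false at the root of the two-node model in which
-- E holds only at the top.
module Submission where

open import Defs
open import Data.Product using (Σ; _×_; _,_; proj₁; proj₂; map₂)
open import Relation.Nullary using (¬_)

open import Data.Bool using (Bool; true; false; _∧_; _∨_; not; if_then_else_; T)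
open import Data.Bool.Properties
  using (∨-identityʳ; ∨-conicalˡ; ∨-conicalʳ; ∧-conicalˡ; ∧-conicalʳ; not-injective; T-≡; T-∧)
open import Data.Empty using (⊥; ⊥-elim)
open import Data.List using (List; []; _∷_; _++_)
open import Data.List.Properties using (++-assoc; ++-identityʳ)
open import Data.List.Membership.Propositional using (_∈_)
open import Data.List.Relation.Unary.Any using (here)
open import Data.Nat using (ℕ; zero; suc; _⊔_; _≡ᵇ_; s≤s) renaming (_≤_ to _≤ℕ_)
open import Data.Nat.Properties using (≡ᵇ⇒≡; ⊔-identityʳ; m⊔n≤o⇒m≤o; m⊔n≤o⇒n≤o)
  renaming (≤-refl to ≤ℕ-refl)
open import Data.Sum using (inj₁; inj₂)
open import Data.Unit using (⊤; tt)
open import Data.Vec using (Vec; []; _∷_)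
open import Function using (_∘_; id)
open import Function.Bundles using (_⇔_; mk⇔; Equivalence)
open import Relation.Binary.PropositionalEquality as ≡ using (_≡_; refl; sym; trans; cong; cong₂)

open Equivalence using (to; from)

infix 30 _[_≔_]

_[_≔_] : ∀ {P} → Formula P → ℕ → P → Formula P
A [ x ≔ d ] = subst x (par d) A

rank-subst : ∀ {P} x (t : Term P) A → rank (subst x t A) ≡ rank A
rank-subst x t (atom p ts) = refl
rank-subst x t ⊤'          = refl
rank-subst x t ⊥'          = refl
rank-subst x t (A ∧' B)    = cong₂ (λ a b → suc (a ⊔ b)) (rank-subst x t A) (rank-subst x t B)
rank-subst x t (A ∨' B)    = cong₂ (λ a b → suc (a ⊔ b)) (rank-subst x t A) (rank-subst x t B)
rank-subst x t (A ⇒ B)     = cong₂ (λ a b → suc (a ⊔ b)) (rank-subst x t A) (rank-subst x t B)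
rank-subst x t (¬' A)      = cong suc (rank-subst x t A)
rank-subst x t (∀' y A) with x ≡ᵇ y
... | true  = refl
... | false = cong suc (rank-subst x t A)
rank-subst x t (∃' y A) with x ≡ᵇ y
... | true  = refl
... | false = cong suc (rank-subst x t A)

rank-subst-≤ : ∀ {P n} x (d : P) A → rank A ≤ℕ n → rank (A [ x ≔ d ]) ≤ℕ n
rank-subst-≤ {n = n} x d A = ≡.subst (_≤ℕ n) (sym (rank-subst x (par d) A))

Ψ-subst : ∀ {P} x (t : Term P) {C C'} → Ψ C C' → Ψ (subst x t C) (subst x t C')
Ψ-subst x t step   = step
Ψ-subst x t (∧ˡ p) = ∧ˡ (Ψ-subst x t p)
Ψ-subst x t (∧ʳ p) = ∧ʳ (Ψ-subst x t p)
Ψ-subst x t (∨ˡ p) = ∨ˡ (Ψ-subst x t p)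
Ψ-subst x t (∨ʳ p) = ∨ʳ (Ψ-subst x t p)
Ψ-subst x t (⇒ˡ p) = ⇒ˡ (Ψ-subst x t p)
Ψ-subst x t (⇒ʳ p) = ⇒ʳ (Ψ-subst x t p)
Ψ-subst x t (¬c p) = ¬c (Ψ-subst x t p)
Ψ-subst x t (∀c {y} p) with x ≡ᵇ y
... | true  = ∀c p
... | false = ∀c (Ψ-subst x t p)
Ψ-subst x t (∃c {y} p) with x ≡ᵇ y
... | true  = ∃c p
... | false = ∃c (Ψ-subst x t p)

rank-Ψ : ∀ {P} {C C' : Formula P} → Ψ C C' → rank C ≡ rank C'
rank-Ψ (step {B})     = cong suc (⊔-identityʳ (rank B))
rank-Ψ (∧ˡ {B = B} p) = cong (λ a → suc (a ⊔ rank B)) (rank-Ψ p)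
rank-Ψ (∧ʳ {A} p)     = cong (λ b → suc (rank A ⊔ b)) (rank-Ψ p)
rank-Ψ (∨ˡ {B = B} p) = cong (λ a → suc (a ⊔ rank B)) (rank-Ψ p)
rank-Ψ (∨ʳ {A} p)     = cong (λ b → suc (rank A ⊔ b)) (rank-Ψ p)
rank-Ψ (⇒ˡ {B = B} p) = cong (λ a → suc (a ⊔ rank B)) (rank-Ψ p)
rank-Ψ (⇒ʳ {A} p)     = cong (λ b → suc (rank A ⊔ b)) (rank-Ψ p)
rank-Ψ (¬c p)         = cong suc (rank-Ψ p)
rank-Ψ (∀c p)         = cong suc (rank-Ψ p)
rank-Ψ (∃c p)         = cong suc (rank-Ψ p)

freeIn-Ψ : ∀ {P} x {C C' : Formula P} → Ψ C C' → freeIn x C ≡ freeIn x C'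
freeIn-Ψ x (step {B})     = ∨-identityʳ (freeIn x B)
freeIn-Ψ x (∧ˡ {B = B} p) = cong (_∨ freeIn x B) (freeIn-Ψ x p)
freeIn-Ψ x (∧ʳ {A} p)     = cong (freeIn x A ∨_) (freeIn-Ψ x p)
freeIn-Ψ x (∨ˡ {B = B} p) = cong (_∨ freeIn x B) (freeIn-Ψ x p)
freeIn-Ψ x (∨ʳ {A} p)     = cong (freeIn x A ∨_) (freeIn-Ψ x p)
freeIn-Ψ x (⇒ˡ {B = B} p) = cong (_∨ freeIn x B) (freeIn-Ψ x p)
freeIn-Ψ x (⇒ʳ {A} p)     = cong (freeIn x A ∨_) (freeIn-Ψ x p)
freeIn-Ψ x (¬c p)         = freeIn-Ψ x p
freeIn-Ψ x (∀c {y} p)     = cong (λ b → if x ≡ᵇ y then false else b) (freeIn-Ψ x p)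
freeIn-Ψ x (∃c {y} p)     = cong (λ b → if x ≡ᵇ y then false else b) (freeIn-Ψ x p)

isGN-Ψ : ∀ {P} {C C' : Formula P} → Ψ C C' → isGN C ≡ true → isGN C' ≡ true
isGN-Ψ step   _ = refl
isGN-Ψ (∧ˡ p) e = cong₂ _∧_ (isGN-Ψ p (∧-conicalˡ _ _ e)) (∧-conicalʳ _ _ e)
isGN-Ψ (∧ʳ p) e = cong₂ _∧_ (∧-conicalˡ _ _ e) (isGN-Ψ p (∧-conicalʳ _ _ e))
isGN-Ψ (∨ˡ p) e = cong₂ _∧_ (isGN-Ψ p (∧-conicalˡ _ _ e)) (∧-conicalʳ _ _ e)
isGN-Ψ (∨ʳ p) e = cong₂ _∧_ (∧-conicalˡ _ _ e) (isGN-Ψ p (∧-conicalʳ _ _ e))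
isGN-Ψ (⇒ˡ p) e = cong₂ _∧_ (isGN-Ψ p (∧-conicalˡ _ _ e)) (∧-conicalʳ _ _ e)
isGN-Ψ (⇒ʳ p) e = cong₂ _∧_ (∧-conicalˡ _ _ e) (isGN-Ψ p (∧-conicalʳ _ _ e))
isGN-Ψ (¬c p) _ = refl
isGN-Ψ (∀c p) e = isGN-Ψ p e
isGN-Ψ (∃c p) e = isGN-Ψ p e

freeOutsideGN-Ψ : ∀ {P} x {C C' : Formula P} → Ψ C C' →
                  freeOutsideGN x C ≡ false → freeOutsideGN x C' ≡ false
freeOutsideGN-Ψ x {C} {C'} p h with isGN C' in C'-GN | isGN C in C-GN
... | true  | _    = refl
... | false | true with () ← trans (sym (isGN-Ψ p C-GN)) C'-GN
freeOutsideGN-Ψ x step   h | false | false with () ← C'-GN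
freeOutsideGN-Ψ x (¬c p) h | false | false with () ← C'-GN
freeOutsideGN-Ψ x (∧ˡ p) h | false | false =
  cong₂ _∨_ (freeOutsideGN-Ψ x p (∨-conicalˡ _ _ h)) (∨-conicalʳ _ _ h)
freeOutsideGN-Ψ x (∧ʳ p) h | false | false =
  cong₂ _∨_ (∨-conicalˡ _ _ h) (freeOutsideGN-Ψ x p (∨-conicalʳ _ _ h))
freeOutsideGN-Ψ x (∨ˡ p) h | false | false =
  cong₂ _∨_ (freeOutsideGN-Ψ x p (∨-conicalˡ _ _ h)) (∨-conicalʳ _ _ h)
freeOutsideGN-Ψ x (∨ʳ p) h | false | false =
  cong₂ _∨_ (∨-conicalˡ _ _ h) (freeOutsideGN-Ψ x p (∨-conicalʳ _ _ h))
freeOutsideGN-Ψ x (⇒ˡ p) h | false | false =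
  cong₂ _∨_ (freeOutsideGN-Ψ x p (∨-conicalˡ _ _ h)) (∨-conicalʳ _ _ h)
freeOutsideGN-Ψ x (⇒ʳ p) h | false | false =
  cong₂ _∨_ (∨-conicalˡ _ _ h) (freeOutsideGN-Ψ x p (∨-conicalʳ _ _ h))
freeOutsideGN-Ψ x (∀c {y} p) h | false | false with x ≡ᵇ y
... | true  = refl
... | false = freeOutsideGN-Ψ x p h
freeOutsideGN-Ψ x (∃c {y} p) h | false | false with x ≡ᵇ y
... | true  = refl
... | false = freeOutsideGN-Ψ x p h

global-Ψ : ∀ {P} x {C C' : Formula P} → Ψ C C' → global x C ≡ true → global x C' ≡ true
global-Ψ x p g = cong₂ _∧_ (trans (sym (freeIn-Ψ x p)) (∧-conicalˡ _ _ g))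
                           (cong not (freeOutsideGN-Ψ x p (not-injective (∧-conicalʳ _ _ g))))

mutual
  occT-substT-self : ∀ {P} x (d : P) t → occT x (substT x (par d) t) ≡ false
  occT-substT-self x d (var y) with x ≡ᵇ y in x≡ᵇy
  ... | true  = refl
  ... | false = x≡ᵇy
  occT-substT-self x d (con c)      = refl
  occT-substT-self x d (fun i n ts) = occV-substV-self x d ts
  occT-substT-self x d (par e)      = refl

  occV-substV-self : ∀ {P n} x (d : P) (ts : Vec (Term P) n) → occV x (substV x (par d) ts) ≡ false
  occV-substV-self x d []       = refl
  occV-substV-self x d (t ∷ ts) = cong₂ _∨_ (occT-substT-self x d t) (occV-substV-self x d ts)

mutual
  occT-substT-other : ∀ {P} y x (d : P) t → occT y t ≡ false → occT y (substT x (par d) t) ≡ false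
  occT-substT-other y x d (var z) h with x ≡ᵇ z
  ... | true  = refl
  ... | false = h
  occT-substT-other y x d (con c)      h = refl
  occT-substT-other y x d (fun i n ts) h = occV-substV-other y x d ts h
  occT-substT-other y x d (par e)      h = refl

  occV-substV-other : ∀ {P n} y x (d : P) (ts : Vec (Term P) n) →
                      occV y ts ≡ false → occV y (substV x (par d) ts) ≡ false
  occV-substV-other y x d []       h = refl
  occV-substV-other y x d (t ∷ ts) h =
    cong₂ _∨_ (occT-substT-other y x d t (∨-conicalˡ _ _ h))
              (occV-substV-other y x d ts (∨-conicalʳ _ _ h))

freeIn-subst-self : ∀ {P} x (d : P) A → freeIn x (A [ x ≔ d ]) ≡ false
freeIn-subst-self x d (atom p ts) = occV-substV-self x d ts
freeIn-subst-self x d ⊤'          = refl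
freeIn-subst-self x d ⊥'          = refl
freeIn-subst-self x d (A ∧' B)    = cong₂ _∨_ (freeIn-subst-self x d A) (freeIn-subst-self x d B)
freeIn-subst-self x d (A ∨' B)    = cong₂ _∨_ (freeIn-subst-self x d A) (freeIn-subst-self x d B)
freeIn-subst-self x d (A ⇒ B)     = cong₂ _∨_ (freeIn-subst-self x d A) (freeIn-subst-self x d B)
freeIn-subst-self x d (¬' A)      = freeIn-subst-self x d A
freeIn-subst-self x d (∀' y A) with x ≡ᵇ y in x≡ᵇy
... | true  rewrite x≡ᵇy = refl
... | false rewrite x≡ᵇy = freeIn-subst-self x d A
freeIn-subst-self x d (∃' y A) with x ≡ᵇ y in x≡ᵇy
... | true  rewrite x≡ᵇy = refl
... | false rewrite x≡ᵇy = freeIn-subst-self x d A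

freeIn-subst-other : ∀ {P} y x (d : P) A → freeIn y A ≡ false → freeIn y (A [ x ≔ d ]) ≡ false
freeIn-subst-other y x d (atom p ts) h = occV-substV-other y x d ts h
freeIn-subst-other y x d ⊤'          h = refl
freeIn-subst-other y x d ⊥'          h = refl
freeIn-subst-other y x d (A ∧' B)    h =
  cong₂ _∨_ (freeIn-subst-other y x d A (∨-conicalˡ _ _ h))
            (freeIn-subst-other y x d B (∨-conicalʳ _ _ h))
freeIn-subst-other y x d (A ∨' B)    h =
  cong₂ _∨_ (freeIn-subst-other y x d A (∨-conicalˡ _ _ h))
            (freeIn-subst-other y x d B (∨-conicalʳ _ _ h))
freeIn-subst-other y x d (A ⇒ B)     h =
  cong₂ _∨_ (freeIn-subst-other y x d A (∨-conicalˡ _ _ h))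
            (freeIn-subst-other y x d B (∨-conicalʳ _ _ h))
freeIn-subst-other y x d (¬' A)      h = freeIn-subst-other y x d A h
freeIn-subst-other y x d (∀' z A) h with x ≡ᵇ z
... | true  = h
... | false with y ≡ᵇ z
...   | true  = refl
...   | false = freeIn-subst-other y x d A h
freeIn-subst-other y x d (∃' z A) h with x ≡ᵇ z
... | true  = h
... | false with y ≡ᵇ z
...   | true  = refl
...   | false = freeIn-subst-other y x d A h

closed-subst : ∀ {P} x (A : Formula P) (d : P) → Closed (∀' x A) → Closed (A [ x ≔ d ])
closed-subst x A d cl y with y ≡ᵇ x in y≡ᵇx | cl y
... | true  | _ rewrite ≡ᵇ⇒≡ y x (from T-≡ y≡ᵇx) = freeIn-subst-self x d A
... | false | h = freeIn-subst-other y x d A h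

-- Closed (A ∧' B), Closed (A ∨' B) and Closed (A ⇒ B) all unfold to this hypothesis.
closed-left : ∀ {P} (A B : Formula P) → (∀ y → freeIn y A ∨ freeIn y B ≡ false) → Closed A
closed-left A B cl y = ∨-conicalˡ _ _ (cl y)

closed-right : ∀ {P} (A B : Formula P) → (∀ y → freeIn y A ∨ freeIn y B ≡ false) → Closed B
closed-right A B cl y = ∨-conicalʳ _ _ (cl y)

mutual
  occT-embT : ∀ {D} x (t : Term ⊥) → occT {D} x (embT t) ≡ occT x t
  occT-embT x (var y)      = refl
  occT-embT x (con c)      = refl
  occT-embT x (fun i n ts) = occV-embV x ts

  occV-embV : ∀ {D n} x (ts : Vec (Term ⊥) n) → occV {D} x (embV ts) ≡ occV x ts
  occV-embV x []       = refl
  occV-embV x (t ∷ ts) = cong₂ _∨_ (occT-embT x t) (occV-embV x ts)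

freeIn-emb : ∀ {D} x (A : Fml) → freeIn {D} x (emb A) ≡ freeIn x A
freeIn-emb x (atom p ts) = occV-embV x ts
freeIn-emb x ⊤'          = refl
freeIn-emb x ⊥'          = refl
freeIn-emb x (A ∧' B)    = cong₂ _∨_ (freeIn-emb x A) (freeIn-emb x B)
freeIn-emb x (A ∨' B)    = cong₂ _∨_ (freeIn-emb x A) (freeIn-emb x B)
freeIn-emb x (A ⇒ B)     = cong₂ _∨_ (freeIn-emb x A) (freeIn-emb x B)
freeIn-emb x (¬' A)      = freeIn-emb x A
freeIn-emb x (∀' y A)    = cong (λ b → if x ≡ᵇ y then false else b) (freeIn-emb x A)
freeIn-emb x (∃' y A)    = cong (λ b → if x ≡ᵇ y then false else b) (freeIn-emb x A)

closed-emb : ∀ {D} (A : Fml) → Closed A → Closed {D} (emb A)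
closed-emb A cl y = trans (freeIn-emb y A) (cl y)

Ψ-emb : ∀ {D} {A A' : Fml} → Ψ A A' → Ψ {D} (emb A) (emb A')
Ψ-emb step   = step
Ψ-emb (∧ˡ p) = ∧ˡ (Ψ-emb p)
Ψ-emb (∧ʳ p) = ∧ʳ (Ψ-emb p)
Ψ-emb (∨ˡ p) = ∨ˡ (Ψ-emb p)
Ψ-emb (∨ʳ p) = ∨ʳ (Ψ-emb p)
Ψ-emb (⇒ˡ p) = ⇒ˡ (Ψ-emb p)
Ψ-emb (⇒ʳ p) = ⇒ʳ (Ψ-emb p)
Ψ-emb (¬c p) = ¬c (Ψ-emb p)
Ψ-emb (∀c p) = ∀c (Ψ-emb p)
Ψ-emb (∃c p) = ∃c (Ψ-emb p)

≼-refl : ∀ {l} → l ≼ l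
≼-refl {l} = [] , ++-identityʳ l

≼-trans : ∀ {l₁ l₂ l₃} → l₁ ≼ l₂ → l₂ ≼ l₃ → l₁ ≼ l₃
≼-trans {l₁} (m , refl) (m' , refl) = m ++ m' , sym (++-assoc l₁ m m')

module Forcing (W : Model) where
  open Model W

  K : Set
  K = Node W

  _⊑_ : K → K → Set
  _⊑_ = _≤_ W

  infix 4 _⊩[_]_

  _⊩[_]_ : K → ℕ → Formula D → Set
  k ⊩[ n ] A = forceF W n k A

  ◇ : K → (K → Set) → Set
  ◇ k φ = Σ K λ k' → k ⊑ k' × φ k'

  ◇-now : ∀ {φ} k → φ k → ◇ k φ
  ◇-now k a = k , ≼-refl , a

  ◇-map : ∀ {φ ψ : K → Set} → (∀ {k'} → φ k' → ψ k') → ∀ k → ◇ k φ → ◇ k ψ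
  ◇-map f k = map₂ (map₂ f)

  ◇-bind : ∀ {φ ψ} k → ◇ k φ → Imp W k φ ψ → ◇ k ψ
  ◇-bind k (k' , le , a) f with f k' le a
  ... | k'' , le' , b = k'' , ≼-trans le le' , b

  _⇛_ : (K → Set) → (K → Set) → Set
  φ ⇛ ψ = ∀ k → φ k → ◇ k ψ

  ⇛-refl : ∀ {φ} → φ ⇛ φ
  ⇛-refl = ◇-now

  ⇛-now : ∀ {φ ψ : K → Set} → (∀ k → φ k → ψ k) → φ ⇛ ψ
  ⇛-now f k a = ◇-now k (f k a)

  Imp-⇛ : ∀ {φ φ' ψ ψ'} → φ' ⇛ φ → ψ ⇛ ψ' → ∀ k → Imp W k φ ψ → Imp W k φ' ψ'
  Imp-⇛ φ'⇛φ ψ⇛ψ' k f k' le a' =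
    ◇-bind k' (φ'⇛φ k' a') λ k'' le' a →
      ◇-bind k'' (f k'' (≼-trans le le') a) λ k''' _ → ψ⇛ψ' k'''

  -- Guard (global x A) d is the premise E(d̄) of the instance at d of a quantifier over x in A:
  -- trivial for a global quantifier.
  Guard : Bool → D → K → Set
  Guard true  d k = ⊤
  Guard false d k = k ⊩[ 0 ] atom E (par d ∷ [])

  Guard-mono : ∀ g d {k k'} → k ⊑ k' → Guard g d k → Guard g d k'
  Guard-mono true  d le _ = tt
  Guard-mono false d le e = monotone le E _ e

  Guard-weaken : ∀ {g g' d k} → (g ≡ true → g' ≡ true) → Guard g d k → Guard g' d k
  Guard-weaken {g' = true}  _ _ = tt
  Guard-weaken {false} {false} _ e = e
  Guard-weaken {true}  {false} h _ with () ← h refl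

  forces-∀ : ∀ {n} k x A → k ⊩[ suc n ] ∀' x A ⇔
             (∀ d → Imp W k (Guard (global x A) d) (_⊩[ n ] A [ x ≔ d ]))
  forces-∀ k x A with global x A
  ... | true  = mk⇔ id id
  ... | false = mk⇔ id id

  forces-∃ : ∀ {n} k x A → k ⊩[ suc n ] ∃' x A ⇔
             Σ D (λ d → Guard (global x A) d k × k ⊩[ n ] A [ x ≔ d ])
  forces-∃ k x A with global x A
  ... | true  = mk⇔ (λ (d , a) → d , tt , a) (λ (d , _ , a) → d , a)
  ... | false = mk⇔ id id

  ⊩-mono : ∀ {n k k'} A → k ⊑ k' → k ⊩[ n ] A → k' ⊩[ n ] A
  ⊩-mono (atom p ts) le a = monotone le p _ a
  ⊩-mono ⊤'          le _ = tt
  ⊩-mono {zero} (_ ∧' _) le ()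
  ⊩-mono {zero} (_ ∨' _) le ()
  ⊩-mono {zero} (_ ⇒ _)  le ()
  ⊩-mono {zero} (¬' _)   le ()
  ⊩-mono {zero} (∀' _ _) le ()
  ⊩-mono {zero} (∃' _ _) le ()
  ⊩-mono {suc n} (A ∧' B) le (a , b) = ⊩-mono A le a , ⊩-mono B le b
  ⊩-mono {suc n} (A ∨' B) le (inj₁ a) = inj₁ (⊩-mono A le a)
  ⊩-mono {suc n} (A ∨' B) le (inj₂ b) = inj₂ (⊩-mono B le b)
  ⊩-mono {suc n} (A ⇒ B)  le f = λ k'' le' → f k'' (≼-trans le le')
  ⊩-mono {suc n} (¬' A)   le f = f
  ⊩-mono {suc n} {k} {k'} (∀' x A) le f =
    from (forces-∀ k' x A) λ d k'' le' → to (forces-∀ k x A) f d k'' (≼-trans le le')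
  ⊩-mono {suc n} {k} {k'} (∃' x A) le f with to (forces-∃ k x A) f
  ... | d , g , a =
    from (forces-∃ k' x A) (d , Guard-mono (global x A) d le g , ⊩-mono (A [ x ≔ d ]) le a)

  ⊩-fuel-irrelevant : ∀ {n m k} A → rank A ≤ℕ n → rank A ≤ℕ m → k ⊩[ n ] A → k ⊩[ m ] A
  ⊩-fuel-irrelevant (atom p ts) _ _ a = a
  ⊩-fuel-irrelevant ⊤'          _ _ a = a
  ⊩-fuel-irrelevant (A ∧' B) (s≤s bn) (s≤s bm) (a , b) =
    ⊩-fuel-irrelevant A (m⊔n≤o⇒m≤o _ _ bn) (m⊔n≤o⇒m≤o _ _ bm) a ,
    ⊩-fuel-irrelevant B (m⊔n≤o⇒n≤o _ _ bn) (m⊔n≤o⇒n≤o _ _ bm) b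
  ⊩-fuel-irrelevant (A ∨' B) (s≤s bn) (s≤s bm) (inj₁ a) =
    inj₁ (⊩-fuel-irrelevant A (m⊔n≤o⇒m≤o _ _ bn) (m⊔n≤o⇒m≤o _ _ bm) a)
  ⊩-fuel-irrelevant (A ∨' B) (s≤s bn) (s≤s bm) (inj₂ b) =
    inj₂ (⊩-fuel-irrelevant B (m⊔n≤o⇒n≤o _ _ bn) (m⊔n≤o⇒n≤o _ _ bm) b)
  ⊩-fuel-irrelevant {k = k} (A ⇒ B) (s≤s bn) (s≤s bm) =
    Imp-⇛ (⇛-now λ _ → ⊩-fuel-irrelevant A (m⊔n≤o⇒m≤o _ _ bm) (m⊔n≤o⇒m≤o _ _ bn))
          (⇛-now λ _ → ⊩-fuel-irrelevant B (m⊔n≤o⇒n≤o _ _ bn) (m⊔n≤o⇒n≤o _ _ bm)) k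
  ⊩-fuel-irrelevant (¬' A) (s≤s bn) (s≤s bm) f (k' , a) = f (k' , ⊩-fuel-irrelevant A bm bn a)
  ⊩-fuel-irrelevant {k = k} (∀' x A) (s≤s bn) (s≤s bm) f =
    from (forces-∀ k x A) λ d →
      Imp-⇛ ⇛-refl
            (⇛-now λ _ → ⊩-fuel-irrelevant (A [ x ≔ d ]) (rank-subst-≤ x d A bn) (rank-subst-≤ x d A bm))
            k (to (forces-∀ k x A) f d)
  ⊩-fuel-irrelevant {k = k} (∃' x A) (s≤s bn) (s≤s bm) f with to (forces-∃ k x A) f
  ... | d , g , a =
    from (forces-∃ k x A)
      (d , g , ⊩-fuel-irrelevant (A [ x ≔ d ]) (rank-subst-≤ x d A bn) (rank-subst-≤ x d A bm) a)

module Prevalence (W : Model) (prevalent : Prevalent W) where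
  open Model W
  open Forcing W

  guard-◇ : ∀ g d k → ◇ k (Guard g d)
  guard-◇ true  d k = k , ≼-refl , tt
  guard-◇ false d k = proj₂ prevalent d k

  ⊩-prevalent : ∀ {n} A → Closed A → rank A ≤ℕ n → Σ K (_⊩[ n ] A) → ∀ k → ◇ k (_⊩[ n ] A)
  ⊩-prevalent A cl bn (k' , a) k =
    ◇-map (⊩-fuel-irrelevant A ≤ℕ-refl bn) k
          (proj₁ prevalent A cl (k' , ⊩-fuel-irrelevant A bn ≤ℕ-refl a) k)

  ⊩-∀-⇛ : ∀ {n} x A A' → (∀ d → (_⊩[ n ] A [ x ≔ d ]) ⇛ (_⊩[ n ] A' [ x ≔ d ])) →
          ∀ k → k ⊩[ suc n ] ∀' x A → k ⊩[ suc n ] ∀' x A'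
  ⊩-∀-⇛ x A A' A⇛A' k f =
    from (forces-∀ k x A') λ d →
      Imp-⇛ (λ k' _ → guard-◇ (global x A) d k') (A⇛A' d) k (to (forces-∀ k x A) f d)

  -- Backward transport reaches only some extension: a quantifier that is local in C may be
  -- global in C', and then its premise E(d̄) has to be waited for.
  mutual
    Ψ-forward : ∀ {n C C'} → Ψ C C' → Closed C → rank C ≤ℕ n → ∀ k → k ⊩[ n ] C → k ⊩[ n ] C'
    Ψ-forward (step {B}) cl (s≤s bn) k f (k' , b) =
      proj₂ (proj₂ (◇-bind k (⊩-prevalent B (closed-left B ⊥' cl) (m⊔n≤o⇒m≤o _ _ bn) (k' , b) k) f))
    Ψ-forward (∧ˡ {A} {B = B} p) cl (s≤s bn) k (a , b) =
      Ψ-forward p (closed-left A B cl) (m⊔n≤o⇒m≤o _ _ bn) k a , b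
    Ψ-forward (∧ʳ {A} {B} p) cl (s≤s bn) k (a , b) =
      a , Ψ-forward p (closed-right A B cl) (m⊔n≤o⇒n≤o _ _ bn) k b
    Ψ-forward (∨ˡ {A} {B = B} p) cl (s≤s bn) k (inj₁ a) =
      inj₁ (Ψ-forward p (closed-left A B cl) (m⊔n≤o⇒m≤o _ _ bn) k a)
    Ψ-forward (∨ˡ p) cl (s≤s bn) k (inj₂ b) = inj₂ b
    Ψ-forward (∨ʳ p) cl (s≤s bn) k (inj₁ a) = inj₁ a
    Ψ-forward (∨ʳ {A} {B} p) cl (s≤s bn) k (inj₂ b) =
      inj₂ (Ψ-forward p (closed-right A B cl) (m⊔n≤o⇒n≤o _ _ bn) k b)
    Ψ-forward (⇒ˡ {A} {B = B} p) cl (s≤s bn) =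
      Imp-⇛ (Ψ-backward p (closed-left A B cl) (m⊔n≤o⇒m≤o _ _ bn)) ⇛-refl
    Ψ-forward (⇒ʳ {A} {B} p) cl (s≤s bn) =
      Imp-⇛ ⇛-refl (⇛-now (Ψ-forward p (closed-right A B cl) (m⊔n≤o⇒n≤o _ _ bn)))
    Ψ-forward (¬c p) cl (s≤s bn) k f (k' , a') = f (map₂ proj₂ (Ψ-backward p cl bn k' a'))
    Ψ-forward (∀c {x} {A} {A'} p) cl (s≤s bn) =
      ⊩-∀-⇛ x A A' λ d →
        ⇛-now (Ψ-forward (Ψ-subst x (par d) p) (closed-subst x A d cl) (rank-subst-≤ x d A bn))
    Ψ-forward (∃c {x} {A} {A'} p) cl (s≤s bn) k f with to (forces-∃ k x A) f
    ... | d , g , a =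
      from (forces-∃ k x A')
        ( d
        , Guard-weaken (global-Ψ x p) g
        , Ψ-forward (Ψ-subst x (par d) p) (closed-subst x A d cl) (rank-subst-≤ x d A bn) k a)

    Ψ-backward : ∀ {n C C'} → Ψ C C' → Closed C → rank C ≤ℕ n → (_⊩[ n ] C') ⇛ (_⊩[ n ] C)
    Ψ-backward step cl (s≤s bn) k f = ◇-now k λ k' _ b → ⊥-elim (f (k' , b))
    Ψ-backward (∧ˡ {A} {B = B} p) cl (s≤s bn) k (a' , b) =
      ◇-bind k (Ψ-backward p (closed-left A B cl) (m⊔n≤o⇒m≤o _ _ bn) k a') λ k' le a →
        ◇-now k' (a , ⊩-mono B le b)
    Ψ-backward (∧ʳ {A} {B} p) cl (s≤s bn) k (a , b') =
      ◇-bind k (Ψ-backward p (closed-right A B cl) (m⊔n≤o⇒n≤o _ _ bn) k b') λ k' le b →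
        ◇-now k' (⊩-mono A le a , b)
    Ψ-backward (∨ˡ {A} {B = B} p) cl (s≤s bn) k (inj₁ a') =
      ◇-map inj₁ k (Ψ-backward p (closed-left A B cl) (m⊔n≤o⇒m≤o _ _ bn) k a')
    Ψ-backward (∨ˡ p) cl (s≤s bn) k (inj₂ b) = ◇-now k (inj₂ b)
    Ψ-backward (∨ʳ p) cl (s≤s bn) k (inj₁ a) = ◇-now k (inj₁ a)
    Ψ-backward (∨ʳ {A} {B} p) cl (s≤s bn) k (inj₂ b') =
      ◇-map inj₂ k (Ψ-backward p (closed-right A B cl) (m⊔n≤o⇒n≤o _ _ bn) k b')
    Ψ-backward (⇒ˡ {A} {B = B} p) cl (s≤s bn) k f =
      ◇-now k (Imp-⇛ (⇛-now (Ψ-forward p (closed-left A B cl) (m⊔n≤o⇒m≤o _ _ bn))) ⇛-refl k f)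
    Ψ-backward (⇒ʳ {A} {B} p) cl (s≤s bn) k f =
      ◇-now k (Imp-⇛ ⇛-refl (Ψ-backward p (closed-right A B cl) (m⊔n≤o⇒n≤o _ _ bn)) k f)
    Ψ-backward (¬c p) cl (s≤s bn) k f = ◇-now k λ (k' , a) → f (k' , Ψ-forward p cl bn k' a)
    Ψ-backward (∀c {x} {A} {A'} p) cl (s≤s bn) k f =
      ◇-now k (⊩-∀-⇛ x A' A (λ d → Ψ-backward (Ψ-subst x (par d) p) (closed-subst x A d cl)
                                                  (rank-subst-≤ x d A bn)) k f)
    Ψ-backward (∃c {x} {A} {A'} p) cl (s≤s bn) k f with to (forces-∃ k x A') f
    ... | d , _ , a' =
      ◇-bind k (Ψ-backward (Ψ-subst x (par d) p) (closed-subst x A d cl) (rank-subst-≤ x d A bn) k a')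
        λ k' _ a → ◇-bind k' (guard-◇ (global x A) d k') λ k'' le g →
          ◇-now k'' (from (forces-∃ k'' x A) (d , g , ⊩-mono (A [ x ≔ d ]) le a))

Ψ-preserves-SFQP : ∀ {A A'} → Ψ A A' → SFQP A → SFQP A'
Ψ-preserves-SFQP {A} {A'} p (cl , valid) = closed' , λ W prevalent k →
  ≡.subst (λ r → forceF W r k (emb A')) (rank-Ψ (Ψ-emb p))
    (Prevalence.Ψ-forward W prevalent (Ψ-emb p) (closed-emb A cl) ≤ℕ-refl k (valid W prevalent k))
  where
  closed' : Closed A'
  closed' y = trans (sym (freeIn-Ψ y p)) (cl y)

Ψ^-⊆ : ∀ {X Y : Fml → Set₁} → (∀ {A A'} → Ψ A A' → Y A → Y A') → (∀ {A} → X A → Y A) →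
       ∀ n {A} → Ψ^ n X A → Y A
Ψ^-⊆ Ψ-closed X⊆Y zero    x            = X⊆Y x
Ψ^-⊆ Ψ-closed X⊆Y (suc n) (_ , h , p) = Ψ-closed p (Ψ^-⊆ Ψ-closed X⊆Y n h)

⋃Ψ⊆SFQP : ∀ A → ⋃Ψ A → SFQP A
⋃Ψ⊆SFQP A (n , h) = Ψ^-⊆ Ψ-preserves-SFQP proj₁ n h

elim¬ : ∀ {P} → Formula P → Formula P
elim¬ (atom p ts) = atom p ts
elim¬ ⊤'          = ⊤'
elim¬ ⊥'          = ⊥'
elim¬ (A ∧' B)    = elim¬ A ∧' elim¬ B
elim¬ (A ∨' B)    = elim¬ A ∨' elim¬ B
elim¬ (A ⇒ B)     = elim¬ A ⇒ elim¬ B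
elim¬ (¬' A)      = ∼ elim¬ A
elim¬ (∀' y A)    = ∀' y (elim¬ A)
elim¬ (∃' y A)    = ∃' y (elim¬ A)

elim¬-Ψ : ∀ {P} {A A' : Formula P} → Ψ A A' → elim¬ A ≡ elim¬ A'
elim¬-Ψ step           = refl
elim¬-Ψ (∧ˡ {B = B} p) = cong (_∧' elim¬ B) (elim¬-Ψ p)
elim¬-Ψ (∧ʳ {A} p)     = cong (elim¬ A ∧'_) (elim¬-Ψ p)
elim¬-Ψ (∨ˡ {B = B} p) = cong (_∨' elim¬ B) (elim¬-Ψ p)
elim¬-Ψ (∨ʳ {A} p)     = cong (elim¬ A ∨'_) (elim¬-Ψ p)
elim¬-Ψ (⇒ˡ {B = B} p) = cong (_⇒ elim¬ B) (elim¬-Ψ p)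
elim¬-Ψ (⇒ʳ {A} p)     = cong (elim¬ A ⇒_) (elim¬-Ψ p)
elim¬-Ψ (¬c p)         = cong ∼_ (elim¬-Ψ p)
elim¬-Ψ (∀c {y} p)     = cong (∀' y) (elim¬-Ψ p)
elim¬-Ψ (∃c {y} p)     = cong (∃' y) (elim¬-Ψ p)

elim¬-noNeg : ∀ {P} (A : Formula P) → T (noNeg A) → elim¬ A ≡ A
elim¬-noNeg (atom p ts) _ = refl
elim¬-noNeg ⊤'          _ = refl
elim¬-noNeg ⊥'          _ = refl
elim¬-noNeg (A ∧' B)    h = cong₂ _∧'_ (elim¬-noNeg A (proj₁ (to T-∧ h))) (elim¬-noNeg B (proj₂ (to T-∧ h)))
elim¬-noNeg (A ∨' B)    h = cong₂ _∨'_ (elim¬-noNeg A (proj₁ (to T-∧ h))) (elim¬-noNeg B (proj₂ (to T-∧ h)))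
elim¬-noNeg (A ⇒ B)     h = cong₂ _⇒_ (elim¬-noNeg A (proj₁ (to T-∧ h))) (elim¬-noNeg B (proj₂ (to T-∧ h)))
elim¬-noNeg (∀' y A)    h = cong (∀' y) (elim¬-noNeg A h)
elim¬-noNeg (∃' y A)    h = cong (∃' y) (elim¬-noNeg A h)

⋃Ψ⇒SFQP-elim¬ : ∀ {A} → ⋃Ψ A → SFQP (elim¬ A)
⋃Ψ⇒SFQP-elim¬ (n , h) =
  Ψ^-⊆ {Y = SFQP ∘ elim¬} (λ p → ≡.subst SFQP (elim¬-Ψ p))
       (λ {A} (valid , noNeg) → ≡.subst SFQP (sym (elim¬-noNeg A noNeg)) valid) n h

data TwoNodes : List ℕ → Set where
  bottom : TwoNodes []
  top    : TwoNodes (0 ∷ [])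

TwoNodes-prefixClosed : ∀ l m → TwoNodes (l ++ m) → TwoNodes l
TwoNodes-prefixClosed []          _       _   = bottom
TwoNodes-prefixClosed (_ ∷ [])    []      top = top
TwoNodes-prefixClosed (_ ∷ [])    (_ ∷ _) ()
TwoNodes-prefixClosed (_ ∷ _ ∷ _) _       ()

E-at-top : Σ (List ℕ) TwoNodes → (p : PSym) → Vec ⊤ (arity p) → Set
E-at-top (_ , bottom) _        _ = ⊥
E-at-top (_ , top)    E        _ = ⊤
E-at-top (_ , top)    (Pr _ _) _ = ⊥

E-at-top-monotone : ∀ {k k'} → proj₁ k ≼ proj₁ k' → ∀ p ds → E-at-top k p ds → E-at-top k' p ds
E-at-top-monotone {_ , bottom} _        _ _ ()
E-at-top-monotone {_ , top} {_ , top}    _        _ _ e = e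
E-at-top-monotone {_ , top} {_ , bottom} (_ , ()) _ _ _

E-at-top-strict : ∀ k p (ts : Vec (Term ⊤) (arity p)) → (∀ x → occV x ts ≡ false) →
                  E-at-top k p (JVof tt (λ _ → tt) (λ _ _ _ → tt) ts) →
                  ∀ s → SubtermOfArgs s ts → E-at-top k E (Jof tt (λ _ → tt) (λ _ _ _ → tt) s ∷ [])
E-at-top-strict (_ , top) E _ _ _ _ _ = tt

E-at-top-only-E : ∀ k p ds → E-at-top k p ds → p ∈ (E ∷ [])
E-at-top-only-E (_ , top) E _ _ = here refl

TwoNodeModel : Model
TwoNodeModel = record
  { InK        = TwoNodes
  ; root       = bottom
  ; prefClosed = TwoNodes-prefixClosed
  ; D          = ⊤
  ; d₀         = tt
  ; conI       = λ _ → tt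
  ; funI       = λ _ _ _ → tt
  ; ext        = E-at-top
  ; monotone   = λ {k} {k'} → E-at-top-monotone {k} {k'}
  ; strict     = E-at-top-strict
  ; finVerif   = λ k → E ∷ [] , E-at-top-only-E k
  }

topNode : Node TwoNodeModel
topNode = 0 ∷ [] , top

⊑-topNode : ∀ k → _≤_ TwoNodeModel k topNode
⊑-topNode (_ , bottom) = 0 ∷ [] , refl
⊑-topNode (_ , top)    = [] , refl

TwoNodeModel-prevalent : Prevalent TwoNodeModel
TwoNodeModel-prevalent =
  (λ A _ (k , a) k' → topNode , ⊑-topNode k' , Forcing.⊩-mono TwoNodeModel A (⊑-topNode k) a) ,
  (λ _ k → topNode , ⊑-topNode k , tt)

∃¬¬E : Fml
∃¬¬E = ∃' 0 (¬' (¬' (atom E (var 0 ∷ []))))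

∃¬¬E-closed : Closed ∃¬¬E
∃¬¬E-closed zero    = refl
∃¬¬E-closed (suc _) = refl

∃¬¬E-valid : SFQP ∃¬¬E
∃¬¬E-valid = ∃¬¬E-closed , λ W prevalent k →
  Model.d₀ W , λ (k' , ¬E) → ¬E (map₂ proj₂ (proj₂ prevalent (Model.d₀ W) k'))

∃¬¬E∉⋃Ψ : ¬ ⋃Ψ ∃¬¬E
∃¬¬E∉⋃Ψ h with proj₂ (⋃Ψ⇒SFQP-elim¬ h) TwoNodeModel TwoNodeModel-prevalent ([] , bottom)
... | _ , () , _

mainTheorem19 : (∀ (A : Fml) → ⋃Ψ A → SFQP A)
                × (Σ Fml λ A → SFQP A × ¬ ⋃Ψ A)
mainTheorem19 = ⋃Ψ⊆SFQP , ∃¬¬E , ∃¬¬E-valid , ∃¬¬E∉⋃Ψ
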